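{- Let $\beta_1=1$, $\beta_2=\frac52$, $\beta_3=\frac92$, $\beta_4=\frac{27}{4}$, and $\beta_i=\frac94(i-1)-\sum_{j=6}^{i+1}\frac{1}{2j}$ for integers $i\ge5$. Let $s,t,i$ be integers with $i\ge4$, $s+t=i$ and $2\le s\le t\le i-2$. Then $$\beta_i\ge\beta_s+\beta_t+\frac{2i-1}{i}.$$ -}

module Defs where

open import Data.Nat as ℕ using (ℕ; zero; suc; _≤ᵇ_)
open import Data.Bool using (if_then_else_)
open import Data.Integer using (+_)
open import Data.Rational using (ℚ; _/_; _+_; _-_; _*_; 0ℚ; 1ℚ)

harmonicTail : ℕ → ℚ
harmonicTail zero    = 0ℚ
harmonicTail (suc n) =
  if 6 ≤ᵇ suc n
  then harmonicTail n + (+ 1 / (2 ℕ.* suc n))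
  else harmonicTail n

-- β_i for i ≥ 1; β 0 is an unused junk value (0).
β : ℕ → ℚ
β zero = 0ℚ
β 1 = 1ℚ
β 2 = + 5 / 2
β 3 = + 9 / 2
β 4 = + 27 / 4
β (suc i) = (+ 9 / 4) * (+ i / 1) - harmonicTail (suc (suc i))

module Submission where

-- Write H n = Σ_{j=6}^{n} 1/(2j) for the harmonic tail and L n = (9/4)·n, so
-- that β (m+1) = L m − H (m+2) for m ≥ 4.  For t ≥ 6 and i = s + t the
-- linear parts cancel (L is additive) and, with X = t + 1 and c the
-- correction (2i−1)/i, the claim becomes the key estimate
--     β s + c + H (s + X) ≤ L s + H X.
-- For s = 2 it follows from H (X+2) − H X ≤ 1/(X+1) = 1/i = 2 − c.  For s ≥ 3
-- we use c ≤ 2, the identity β s + H (s+1) + 9/4 = L s and the window bound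
--     H (s + X) ≤ H X + H (s + 1) + 1/4   (X ≥ 7),
-- obtained by comparing the first four new terms with 1/16 and the remaining
-- ones termwise with the terms of H (s + 1).  The finitely many cases t ≤ 5
-- are decided by computation.

open import Data.Nat as ℕ using (ℕ; zero; suc; _≤_; _<_; z≤n; s≤s)
import Data.Nat.Properties as ℕP
open import Data.Integer as ℤ using (+_)
import Data.Integer.Properties as ℤP
open import Data.Integer.Solver using (module +-*-Solver)
open import Data.Product using (_,_)
open import Data.Rational using (ℚ; 0ℚ; 1ℚ; _/_; _+_; _-_; _*_; toℚᵘ; _≤?_)
  renaming (_≤_ to _≤ℚ_)
open import Data.Rational.Properties
open import Data.Rational.Unnormalised as ℚᵘ using (mkℚᵘ; *≡*; *≤*)
import Data.Rational.Unnormalised.Properties as ℚᵘP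
import Data.Rational.Solver as ℚSolver
open import Relation.Binary.PropositionalEquality
open import Relation.Nullary using (Dec; yes; no)
open import Relation.Nullary.Decidable using (toWitness)
open import Defs

toℚᵘ-/ : ∀ p k → toℚᵘ (p / suc k) ℚᵘ.≃ mkℚᵘ p k
toℚᵘ-/ p k = toℚᵘ-fromℚᵘ (mkℚᵘ p k)

/-+-/ : ∀ p q d .{{_ : ℕ.NonZero d}} → p / d + q / d ≡ (p ℤ.+ q) / d
/-+-/ p q (suc k) = toℚᵘ-injective (begin-equality
  toℚᵘ (p / d + q / d)              ≃⟨ toℚᵘ-homo-+ (p / d) (q / d) ⟩
  toℚᵘ (p / d) ℚᵘ.+ toℚᵘ (q / d)    ≃⟨ ℚᵘP.+-cong (toℚᵘ-/ p k) (toℚᵘ-/ q k) ⟩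
  mkℚᵘ p k ℚᵘ.+ mkℚᵘ q k            ≃⟨ *≡* numerators ⟩
  mkℚᵘ (p ℤ.+ q) k                  ≃⟨ toℚᵘ-/ (p ℤ.+ q) k ⟨
  toℚᵘ ((p ℤ.+ q) / d)              ∎)
  where
  open ℚᵘP.≤-Reasoning
  open +-*-Solver
  d = suc k
  numerators : (p ℤ.* + d ℤ.+ q ℤ.* + d) ℤ.* + d ≡ (p ℤ.+ q) ℤ.* (+ d ℤ.* + d)
  numerators = solve 3 (λ p q d → (p :* d :+ q :* d) :* d := (p :+ q) :* (d :* d)) refl p q (+ d)

/-≡-/ : ∀ a b m n .{{_ : ℕ.NonZero m}} .{{_ : ℕ.NonZero n}} →
        a ℕ.* n ≡ b ℕ.* m → + a / m ≡ + b / n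
/-≡-/ a b (suc m) (suc n) eq = fromℚᵘ-cong {mkℚᵘ (+ a) m} {mkℚᵘ (+ b) n}
  (*≡* (trans (sym (ℤP.pos-* a (suc n))) (trans (cong +_ eq) (ℤP.pos-* b (suc m)))))

1/-antitone : ∀ {m n} .{{_ : ℕ.NonZero m}} .{{_ : ℕ.NonZero n}} →
              m ≤ n → + 1 / n ≤ℚ + 1 / m
1/-antitone {suc m} {suc n} m≤n = toℚᵘ-cancel-≤ (begin
  toℚᵘ (+ 1 / suc n)  ≃⟨ toℚᵘ-/ (+ 1) n ⟩
  mkℚᵘ (+ 1) n        ≤⟨ *≤* (ℤ.+≤+ (ℕP.*-monoʳ-≤ 1 m≤n)) ⟩
  mkℚᵘ (+ 1) m        ≃⟨ toℚᵘ-/ (+ 1) m ⟨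
  toℚᵘ (+ 1 / suc m)  ∎)
  where open ℚᵘP.≤-Reasoning

ℕ/1-+ : ∀ m n → + (m ℕ.+ n) / 1 ≡ + m / 1 + + n / 1
ℕ/1-+ m n = sym (/-+-/ (+ m) (+ n) 1)

correction : (i : ℕ) .{{_ : ℕ.NonZero i}} → ℚ
correction i = + (2 ℕ.* i ℕ.∸ 1) / i

correction-complement : ∀ i .{{_ : ℕ.NonZero i}} → correction i + + 1 / i ≡ + 2 / 1
correction-complement i@(suc k) = trans (/-+-/ (+ (2 ℕ.* i ℕ.∸ 1)) (+ 1) i)
  (/-≡-/ (2 ℕ.* i ℕ.∸ 1 ℕ.+ 1) 2 i 1 (begin
    (2 ℕ.* i ℕ.∸ 1 ℕ.+ 1) ℕ.* 1  ≡⟨ ℕP.*-identityʳ _ ⟩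
    2 ℕ.* i ℕ.∸ 1 ℕ.+ 1          ≡⟨ ℕP.m∸n+n≡m (s≤s z≤n) ⟩
    2 ℕ.* i                      ∎))
  where open ≡-Reasoning

correction≤2 : ∀ i .{{_ : ℕ.NonZero i}} → correction i ≤ℚ + 2 / 1
correction≤2 i = begin
  correction i              ≡⟨ +-identityʳ (correction i) ⟨
  correction i + 0ℚ         ≤⟨ +-monoʳ-≤ (correction i) (nonNegative⁻¹ _ {{normalize-nonNeg 1 i}}) ⟩
  correction i + + 1 / i    ≡⟨ correction-complement i ⟩
  + 2 / 1                   ∎
  where open ≤-Reasoning

H : ℕ → ℚ
H = harmonicTail

term : ℕ → ℚ
term n = + 1 / (2 ℕ.* suc n)

tail-step : ∀ n → 5 ≤ n → H (suc n) ≡ H n + term n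
tail-step _ (s≤s (s≤s (s≤s (s≤s (s≤s _))))) = refl

term-antitone : ∀ {m n} → m ≤ n → term n ≤ℚ term m
term-antitone m≤n = 1/-antitone (ℕP.*-monoʳ-≤ 2 (s≤s m≤n))

term-double : ∀ n → term n + term n ≡ + 1 / suc n
term-double n = trans (/-+-/ (+ 1) (+ 1) (2 ℕ.* suc n))
  (/-≡-/ 2 1 (2 ℕ.* suc n) (suc n) (sym (ℕP.*-identityˡ (2 ℕ.* suc n))))

tail-growth : ∀ {m X} → m ≤ X → 5 ≤ X → ∀ d → H (d ℕ.+ X) ≤ℚ H X + (+ d / 1) * term m
tail-growth {m} {X} _ _ zero =
  ≤-reflexive (sym (trans (cong (_+_ (H X)) (*-zeroˡ (term m))) (+-identityʳ (H X))))
tail-growth {m} {X} m≤X 5≤X (suc d) = begin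
  H (suc (d ℕ.+ X))                 ≡⟨ tail-step (d ℕ.+ X) (ℕP.m≤n⇒m≤o+n d 5≤X) ⟩
  H (d ℕ.+ X) + term (d ℕ.+ X)      ≤⟨ +-mono-≤ (tail-growth m≤X 5≤X d) (term-antitone (ℕP.m≤n⇒m≤o+n d m≤X)) ⟩
  H X + (+ d / 1) * term m + term m ≡⟨ solve 3 (λ h n q → h :+ n :* q :+ q := h :+ (con 1ℚ :+ n) :* q) refl (H X) (+ d / 1) (term m) ⟩
  H X + (1ℚ + + d / 1) * term m     ≡⟨ cong (λ n → H X + n * term m) (ℕ/1-+ 1 d) ⟨
  H X + (+ suc d / 1) * term m      ∎
  where open ≤-Reasoning
        open ℚSolver.+-*-Solver

tail-shift : ∀ {Y} → 5 ≤ Y → ∀ d → H (d ℕ.+ Y) ≤ℚ H Y + H (5 ℕ.+ d)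
tail-shift {Y} _ zero = ≤-reflexive (sym (+-identityʳ (H Y)))
tail-shift {Y} 5≤Y (suc d) = begin
  H (suc (d ℕ.+ Y))                   ≡⟨ tail-step (d ℕ.+ Y) (ℕP.m≤n⇒m≤o+n d 5≤Y) ⟩
  H (d ℕ.+ Y) + term (d ℕ.+ Y)        ≤⟨ +-mono-≤ (tail-shift 5≤Y d) (term-antitone 5+d≤d+Y) ⟩
  H Y + H (5 ℕ.+ d) + term (5 ℕ.+ d)  ≡⟨ +-assoc (H Y) _ _ ⟩
  H Y + (H (5 ℕ.+ d) + term (5 ℕ.+ d)) ≡⟨ cong (_+_ (H Y)) (tail-step (5 ℕ.+ d) (ℕP.m≤m+n 5 d)) ⟨
  H Y + H (6 ℕ.+ d)                   ∎
  where
  open ≤-Reasoning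
  5+d≤d+Y : 5 ℕ.+ d ≤ d ℕ.+ Y
  5+d≤d+Y = subst (_≤ d ℕ.+ Y) (ℕP.+-comm d 5) (ℕP.+-monoʳ-≤ d 5≤Y)

-- For X ≥ 7 a window of s ≥ 3 terms after X is at most H (s + 1) + 1/4: the
-- first four terms are each at most term 7 = 1/16 (at most three when s = 3),
-- and the remaining ones are bounded termwise by those of H (s + 1).
window : ∀ s {X} → 3 ≤ s → 7 ≤ X → H (s ℕ.+ X) ≤ℚ H X + H (suc s) + + 1 / 4
window 1 (s≤s ()) _
window 2 (s≤s (s≤s ())) _
window 3 {X} _ 7≤X = begin
  H (3 ℕ.+ X)                 ≤⟨ tail-growth 7≤X 5≤X 3 ⟩
  H X + (+ 3 / 1) * term 7    ≤⟨ +-monoʳ-≤ (H X) (toWitness {a? = (+ 3 / 1) * term 7 ≤? + 1 / 4} _) ⟩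
  H X + + 1 / 4               ≡⟨ cong (_+ + 1 / 4) (+-identityʳ (H X)) ⟨
  H X + H 4 + + 1 / 4         ∎
  where open ≤-Reasoning
        5≤X : 5 ≤ X
        5≤X = ℕP.≤-trans (ℕP.m≤m+n 5 2) 7≤X
window (suc (suc (suc (suc d)))) {X} _ 7≤X = begin
  H (4 ℕ.+ d ℕ.+ X)                       ≡⟨ cong H (trans (cong (ℕ._+ X) (ℕP.+-comm 4 d)) (ℕP.+-assoc d 4 X)) ⟩
  H (d ℕ.+ (4 ℕ.+ X))                     ≤⟨ tail-shift (ℕP.m≤n⇒m≤o+n 4 5≤X) d ⟩
  H (4 ℕ.+ X) + H (5 ℕ.+ d)               ≤⟨ +-monoˡ-≤ (H (5 ℕ.+ d)) (tail-growth 7≤X 5≤X 4) ⟩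
  H X + (+ 4 / 1) * term 7 + H (5 ℕ.+ d)  ≡⟨ solve 3 (λ h q g → h :+ q :+ g := h :+ g :+ q) refl (H X) ((+ 4 / 1) * term 7) (H (5 ℕ.+ d)) ⟩
  H X + H (5 ℕ.+ d) + (+ 4 / 1) * term 7  ≡⟨⟩
  H X + H (5 ℕ.+ d) + + 1 / 4             ∎
  where open ≤-Reasoning
        open ℚSolver.+-*-Solver
        5≤X : 5 ≤ X
        5≤X = ℕP.≤-trans (ℕP.m≤m+n 5 2) 7≤X

slope : ℕ → ℚ
slope n = (+ 9 / 4) * (+ n / 1)

slope-+ : ∀ m n → slope (m ℕ.+ n) ≡ slope m + slope n
slope-+ m n = trans (cong (_*_ (+ 9 / 4)) (ℕ/1-+ m n)) (*-distribˡ-+ (+ 9 / 4) (+ m / 1) (+ n / 1))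

β-closed : ∀ m → 4 ≤ m → β (suc m) ≡ slope m - H (2 ℕ.+ m)
β-closed _ (s≤s (s≤s (s≤s (s≤s _)))) = refl

β-deficit : ∀ s → 3 ≤ s → β s + H (suc s) + + 9 / 4 ≡ slope s
β-deficit 1 (s≤s ())
β-deficit 2 (s≤s (s≤s ()))
β-deficit 3 _ = refl
β-deficit 4 _ = refl
β-deficit (suc m@(suc (suc (suc (suc k))))) _ = begin
  β (suc m) + H (2 ℕ.+ m) + + 9 / 4              ≡⟨ cong (λ b → b + H (2 ℕ.+ m) + + 9 / 4) (β-closed m (ℕP.m≤m+n 4 k)) ⟩
  slope m - H (2 ℕ.+ m) + H (2 ℕ.+ m) + + 9 / 4  ≡⟨ solve 2 (λ l h → l :- h :+ h :+ con (+ 9 / 4) := con (+ 9 / 4) :+ l) refl (slope m) (H (2 ℕ.+ m)) ⟩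
  slope 1 + slope m                              ≡⟨ slope-+ 1 m ⟨
  slope (suc m)                                  ∎
  where open ≡-Reasoning
        open ℚSolver.+-*-Solver

-- Key estimate for s = 2 (here X = 7 + a and i = X + 1): the two new terms
-- of H sum to at most 1/i, which is exactly what the correction lacks of 2.
key-two : ∀ a → β 2 + (correction (8 ℕ.+ a) + H (9 ℕ.+ a)) ≤ℚ slope 2 + H (7 ℕ.+ a)
key-two a = begin
  β 2 + (c + (H X + term X + term (1 ℕ.+ X)))  ≤⟨ +-monoʳ-≤ (β 2) (+-monoʳ-≤ c (+-monoʳ-≤ (H X + term X) (term-antitone (ℕP.n≤1+n X)))) ⟩
  β 2 + (c + (H X + term X + term X))          ≡⟨ solve 4 (λ b c h q → b :+ (c :+ (h :+ q :+ q)) := b :+ h :+ (c :+ (q :+ q))) refl (β 2) c (H X) (term X) ⟩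
  β 2 + H X + (c + (term X + term X))          ≡⟨ cong (λ q → β 2 + H X + (c + q)) (term-double X) ⟩
  β 2 + H X + (c + + 1 / (8 ℕ.+ a))            ≡⟨ cong (_+_ (β 2 + H X)) (correction-complement (8 ℕ.+ a)) ⟩
  β 2 + H X + + 2 / 1                          ≡⟨ solve 3 (λ b h t → b :+ h :+ t := (b :+ t) :+ h) refl (β 2) (H X) (+ 2 / 1) ⟩
  slope 2 + H X                                ∎
  where
  open ≤-Reasoning
  open ℚSolver.+-*-Solver
  X = 7 ℕ.+ a
  c = correction (8 ℕ.+ a)

-- Key estimate for s ≥ 3 and X ≥ 7: bound the correction by 2 and the window
-- H (s + X) − H X by H (s + 1) + 1/4; then β-deficit closes the gap.
key-large : ∀ s X i .{{_ : ℕ.NonZero i}} → 3 ≤ s → 7 ≤ X →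
            β s + (correction i + H (s ℕ.+ X)) ≤ℚ slope s + H X
key-large s X i 3≤s 7≤X = begin
  β s + (correction i + H (s ℕ.+ X))                ≤⟨ +-monoʳ-≤ (β s) (+-mono-≤ (correction≤2 i) (window s 3≤s 7≤X)) ⟩
  β s + (+ 2 / 1 + (H X + H (suc s) + + 1 / 4))     ≡⟨ solve 3 (λ b h g → b :+ (con (+ 2 / 1) :+ (h :+ g :+ con (+ 1 / 4))) := (b :+ g :+ con (+ 9 / 4)) :+ h) refl (β s) (H X) (H (suc s)) ⟩
  β s + H (suc s) + + 9 / 4 + H X                   ≡⟨ cong (_+ H X) (β-deficit s 3≤s) ⟩
  slope s + H X                                     ∎
  where open ≤-Reasoning
        open ℚSolver.+-*-Solver

key : ∀ s a → 2 ≤ s →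
      β s + (correction (suc (s ℕ.+ (5 ℕ.+ a))) + H (s ℕ.+ (7 ℕ.+ a))) ≤ℚ slope s + H (7 ℕ.+ a)
key 1 _ (s≤s ())
key 2 a _ = key-two a
key s@(suc (suc (suc _))) a _ = key-large s (7 ℕ.+ a) (suc (s ℕ.+ (5 ℕ.+ a))) (s≤s (s≤s (s≤s z≤n))) (ℕP.m≤m+n 7 a)

rearrange : ∀ b c h′ e h l → b + (c + h′) ≤ℚ l + h → (b + (e - h)) + c ≤ℚ (l + e) - h′
rearrange b c h′ e h l b+c+h′≤l+h = subst₂ _≤ℚ_ lhs rhs (+-monoˡ-≤ (e - h - h′) b+c+h′≤l+h)
  where
  open ℚSolver.+-*-Solver
  lhs : b + (c + h′) + (e - h - h′) ≡ (b + (e - h)) + c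
  lhs = solve 5 (λ b c h′ e h → b :+ (c :+ h′) :+ (e :- h :- h′) := (b :+ (e :- h)) :+ c) refl b c h′ e h
  rhs : l + h + (e - h - h′) ≡ (l + e) - h′
  rhs = solve 4 (λ l h′ e h → l :+ h :+ (e :- h :- h′) := (l :+ e) :- h′) refl l h′ e h

-- The lemma for t ≥ 6: writing t = 6 + a and i = n + 1 with n = s + 5 + a,
-- the linear parts of β s + β t and β i cancel and the key estimate remains.
large-case : ∀ {s t j} → 2 ≤ s → 6 ≤ t → s ℕ.+ t ≡ suc j →
             (β s + β t) + correction (suc j) ≤ℚ β (suc j)
large-case {s} 2≤s 6≤t s+t≡1+j
  with a , refl ← ℕP.m≤n⇒∃[o]m+o≡n 6≤t
  with refl ← ℕP.suc-injective (trans (sym (ℕP.+-suc s (5 ℕ.+ a))) s+t≡1+j) = begin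
    β s + (slope (5 ℕ.+ a) - H (7 ℕ.+ a)) + c    ≤⟨ rearrange (β s) c (H (s ℕ.+ (7 ℕ.+ a))) (slope (5 ℕ.+ a)) (H (7 ℕ.+ a)) (slope s) (key s a 2≤s) ⟩
    slope s + slope (5 ℕ.+ a) - H (s ℕ.+ (7 ℕ.+ a)) ≡⟨ cong₂ _-_ (slope-+ s (5 ℕ.+ a)) (cong H 2+n≡s+7+a) ⟨
    slope n - H (2 ℕ.+ n)                        ≡⟨ β-closed n (ℕP.m≤n⇒m≤o+n s (ℕP.m≤m+n 4 (suc a))) ⟨
    β (suc n)                                    ∎
  where
  open ≤-Reasoning
  n = s ℕ.+ (5 ℕ.+ a)
  c = correction (suc n)
  2+n≡s+7+a : 2 ℕ.+ n ≡ s ℕ.+ (7 ℕ.+ a)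
  2+n≡s+7+a = sym (trans (ℕP.+-suc s (6 ℕ.+ a)) (cong suc (ℕP.+-suc s (5 ℕ.+ a))))

Shifted : ℕ → ℕ → Set
Shifted s′ t′ = (β (2 ℕ.+ s′) + β (2 ℕ.+ t′)) + correction (2 ℕ.+ s′ ℕ.+ (2 ℕ.+ t′))
                ≤ℚ β (2 ℕ.+ s′ ℕ.+ (2 ℕ.+ t′))

-- The ten cases 2 ≤ s ≤ t ≤ 5, decided by computation.
small-cases : ∀ {t′} → t′ < 4 → ∀ {s′} → s′ < suc t′ → Shifted s′ t′
small-cases = toWitness {a? = ℕP.allUpTo? (λ t′ → ℕP.allUpTo? (λ s′ → shifted? s′ t′) (suc t′)) 4} _
  where
  shifted? : ∀ s′ t′ → Dec (Shifted s′ t′)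
  shifted? s′ t′ = _ ≤? _

small-case : ∀ {s t j} → 2 ≤ s → s ≤ t → t < 6 → s ℕ.+ t ≡ suc j →
             (β s + β t) + correction (suc j) ≤ℚ β (suc j)
small-case (s≤s (s≤s z≤n)) (s≤s (s≤s s′≤t′)) (s≤s (s≤s t′<4)) refl = small-cases t′<4 (s≤s s′≤t′)

-- Lemma 3.1.  Split on t ≥ 6; the bounds 4 ≤ i and t ≤ i − 2 are implied by
-- s + t = i and 2 ≤ s ≤ t.
lemma3p1 : (s t i : ℕ) → 4 ≤ i → s ℕ.+ t ≡ i → 2 ≤ s → s ≤ t → t ≤ i ℕ.∸ 2 →
    {{_ : ℕ.NonZero i}} →
    (β s + β t) + (+ (2 ℕ.* i ℕ.∸ 1) / i) ≤ℚ β i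
lemma3p1 s t (suc j) _ s+t≡i 2≤s s≤t _ with 6 ℕ.≤? t
... | yes 6≤t = large-case 2≤s 6≤t s+t≡i
... | no  6≰t = small-case 2≤s s≤t (ℕP.≰⇒> 6≰t) s+t≡i
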